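{- Let $G$ be a planar triangulation and $v_0\in V(G)$. For every integer $k\ge 0$, the extended degree-bounded ball satisfies $|V(\bar B^8_k(v_0))| < 5^k\, d(v_0)$.
   Context: A planar triangulation is a simple graph embedded in the sphere all of whose faces are triangles; $d(v)$ is the degree of $v$ in $G$. Let $V_1$ be the set of vertices $v_1$ of $G$ for which there is a path from $v_0$ to $v_1$ of length at most $k$ all of whose vertices other than $v_0$ have degree at most $8$ (so $v_0\in V_1$). The degree-bounded ball $B^8_k(v_0)$ is the subgraph of $G$ induced by $V_1$. Let $V_2$ be the set of vertices $v\ne v_0$ of degree at least $9$ for which there is a path from $v_0$ to $v$ of length at most $k$ whose internal vertices all have degree at most $8$. The extended degree-bounded ball is $\bar B^8_k(v_0)=G[V_1\cup V_2]$. -}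

module Defs where

open import Data.Nat using (ℕ; zero; suc; _+_; _*_; _≤_; _<_)
open import Data.Fin using (Fin; fromℕ; toℕ) renaming (zero to fzero)
open import Data.Fin.Properties using (any?) renaming (_≟_ to _≟ᶠ_)
open import Data.Fin.Subset using (Subset; _∈_; ∣_∣)
open import Data.List using (List; length; filter; allFin)
open import Data.Product using (Σ; ∃; _×_; _,_)
open import Data.Sum using (_⊎_)
open import Function using (_∘_; Injective)
open import Relation.Binary.PropositionalEquality using (_≡_; _≢_)
open import Relation.Binary.Construct.Closure.ReflexiveTransitive using (Star)
open import Relation.Nullary using (Dec; ¬_)
open import Relation.Nullary.Decidable using (_×-dec_)

iterate : ∀ {A : Set} → (A → A) → ℕ → A → A
iterate f zero    x = x
iterate f (suc i) x = f (iterate f i x)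

-- A planar triangulation, given combinatorially as a rotation system
-- (combinatorial map) on n vertices with D darts (half-edges).
--   tail d : vertex at which dart d starts
--   α      : fixed-point-free involution pairing the two darts of an edge
--   σ      : rotation (a permutation of darts, cyclically ordering the
--            darts around each vertex)
--   faces  : orbits of φ = σ ∘ α
-- Conditions: simple graph (no loops, no multiple edges), connected,
-- every face a triangle, and Euler's formula V - E + F = 2 (genus 0,
-- i.e. the map is an embedding in the sphere). With E = D/2 and
-- F = D/3 (all faces triangles), V - E + F = 2 is equivalent to 6V = D + 12.
record PlanarTriangulation (n D : ℕ) : Set where
  field
    tail     : Fin D → Fin n
    α        : Fin D → Fin D
    σ        : Fin D → Fin D
    σ⁻¹      : Fin D → Fin D
    α-invol  : ∀ d → α (α d) ≡ d
    α-nofix  : ∀ d → α d ≢ d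
    σ-inv₁   : ∀ d → σ (σ⁻¹ d) ≡ d
    σ-inv₂   : ∀ d → σ⁻¹ (σ d) ≡ d
    σ-tail   : ∀ d → tail (σ d) ≡ tail d
    σ-trans  : ∀ d d' → tail d ≡ tail d' → ∃ λ i → iterate σ i d ≡ d'
    no-loop  : ∀ d → tail (α d) ≢ tail d
    no-multi : ∀ d d' → tail d ≡ tail d' → tail (α d) ≡ tail (α d') → d ≡ d'
  Adj : Fin n → Fin n → Set
  Adj u v = ∃ λ d → tail d ≡ u × tail (α d) ≡ v
  φ : Fin D → Fin D
  φ d = σ (α d)
  field
    face-tri  : ∀ d → φ (φ (φ d)) ≡ d
    face-nfix : ∀ d → φ d ≢ d
    connected : ∀ u v → Star Adj u v
    euler     : 6 * n ≡ D + 12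

module _ {n D : ℕ} (G : PlanarTriangulation n D) where
  open PlanarTriangulation G

  adj? : ∀ u v → Dec (Adj u v)
  adj? u v = any? (λ d → (tail d ≟ᶠ u) ×-dec (tail (α d) ≟ᶠ v))

  deg : Fin n → ℕ
  deg v = length (filter (adj? v) (allFin n))

  record Path (ℓ : ℕ) (u v : Fin n) : Set where
    field
      vtx   : Fin (suc ℓ) → Fin n
      inj   : Injective _≡_ _≡_ vtx
      start : vtx fzero ≡ u
      end   : vtx (fromℕ ℓ) ≡ v
      step  : ∀ (i : Fin ℓ) → Adj (vtx (Data.Fin.inject₁ i)) (vtx (Data.Fin.suc i))

  open Path

  InV₁ : ℕ → Fin n → Fin n → Set
  InV₁ k v₀ v₁ = Σ ℕ λ ℓ → ℓ ≤ k × Σ (Path ℓ v₀ v₁) λ P →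
                   ∀ i → i ≢ fzero → deg (vtx P i) ≤ 8

  InV₂ : ℕ → Fin n → Fin n → Set
  InV₂ k v₀ v = v ≢ v₀ × 9 ≤ deg v × Σ ℕ λ ℓ → ℓ ≤ k × Σ (Path ℓ v₀ v) λ P →
                   ∀ i → i ≢ fzero → i ≢ fromℕ ℓ → deg (vtx P i) ≤ 8

  InExtBall : ℕ → Fin n → Fin n → Set
  InExtBall k v₀ v = InV₁ k v₀ v ⊎ InV₂ k v₀ v

-- Explore the triangulation from v₀ along directed edges (p , w): the frontier at
-- step i + 1 consists of the edges (w , u) such that (p , w) lies in the frontier
-- at step i, d(w) ≤ 8, and u is neither p nor a neighbour of p. Every vertex of
-- the extended ball is explored within k steps, because a path leaving w towards
-- p or a neighbour of p only reaches a vertex explored one step earlier. The two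
-- faces on the edge pw supply two common neighbours of p and w, so w has at most
-- d(w) − 3 ≤ 5 admissible u; if the two coincide, the rotation at w has period 2
-- and there is no admissible u at all. Hence the i-th frontier has at most
-- 5^i d(v₀) edges, and since d(v₀) ≥ 2 fewer than 5^k d(v₀) vertices are explored.
module Submission where

open import Defs
open import Data.Nat using (ℕ; _*_; _^_; _<_)
open import Data.Fin using (Fin)
open import Data.Fin.Subset using (Subset; _∈_; ∣_∣)

open import Data.Nat using (zero; suc; _+_; _∸_; _≤_; _≤′_; ≤′-refl; ≤′-step; z≤n; s≤s; _≤?_)
open import Data.Nat.Properties
open import Data.Fin using (zero; suc; toℕ; fromℕ; inject₁; punchIn) renaming (_≟_ to _≟ᶠ_)
open import Data.Fin.Properties using (toℕ-inject₁; toℕ-fromℕ; fromℕ≢inject₁; punchInᵢ≢i; injective⇒≤)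
open import Data.Fin.Induction using (<-weakInduction)
open import Data.Fin.Subset using (outside; inside; _∪_; ⋃; ⁅_⁆)
open import Data.Fin.Subset.Properties using (p⊆q⇒∣p∣≤∣q∣; ∣⊥∣≡0; ∣⁅x⁆∣≡1; x∈⁅x⁆; x∈p∪q⁺)
open import Data.Vec using ([]; _∷_)
open import Data.List using (List; []; _∷_; _++_; length; map; filter; allFin; lookup; concatMap)
open import Data.List.Properties using (length-++; length-map; length-filter)
open import Data.List.Membership.Propositional using (lose; find) renaming (_∈_ to _∈ˡ_)
open import Data.List.Membership.Propositional.Properties
  using ( ∈-lookup; ∈-allFin; ∈-filter⁺; ∈-filter⁻; ∈-map⁺; ∈-map⁻
        ; ∈-++⁺ˡ; ∈-++⁺ʳ; ∈-++⁻; ∈-concatMap⁺; ∈-concatMap⁻)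
open import Data.List.Membership.Setoid.Properties using (index-injective)
open import Data.List.Relation.Binary.Subset.Propositional using () renaming (_⊆_ to _⊆ˡ_)
open import Data.List.Relation.Unary.Any using (here; there; index)
open import Data.List.Relation.Unary.All as All using (All; []; _∷_)
open import Data.List.Relation.Unary.AllPairs using ([]; _∷_)
open import Data.List.Relation.Unary.Unique.Propositional using (Unique)
import Data.List.Relation.Unary.Unique.Propositional.Properties as Unique
open import Data.Product using (∃; _×_; _,_; proj₁; proj₂)
open import Data.Sum as Sum using (_⊎_; inj₁; inj₂)
open import Function using (_∘_; id; Injective)
open import Relation.Binary.PropositionalEquality
open import Relation.Binary.Construct.Closure.ReflexiveTransitive using (ε; _◅_)
open import Relation.Nullary using (Dec; yes; no; ¬_; ¬?; contradiction)
open import Relation.Nullary.Decidable using (_×-dec_)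

module _ {A : Set} where

  Unique⇒lookup-injective : ∀ {xs : List A} → Unique xs → Injective _≡_ _≡_ (lookup xs)
  Unique⇒lookup-injective (_  ∷ _) {zero}  {zero}  _  = refl
  Unique⇒lookup-injective (x∉ ∷ _) {zero}  {suc j} eq = contradiction eq (All.lookup x∉ (∈-lookup j))
  Unique⇒lookup-injective (x∉ ∷ _) {suc i} {zero}  eq = contradiction (sym eq) (All.lookup x∉ (∈-lookup i))
  Unique⇒lookup-injective (_  ∷ u) {suc i} {suc j} eq = cong suc (Unique⇒lookup-injective u eq)

  Unique⇒length≤ : ∀ {xs ys : List A} → Unique xs → xs ⊆ˡ ys → length xs ≤ length ys
  Unique⇒length≤ {xs} {ys} u xs⊆ys = injective⇒≤ position-injective
    where
      position : Fin (length xs) → Fin (length ys)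
      position i = index (xs⊆ys (∈-lookup i))

      position-injective : Injective _≡_ _≡_ position
      position-injective eq = Unique⇒lookup-injective u
        (index-injective (setoid A) (xs⊆ys (∈-lookup _)) (xs⊆ys (∈-lookup _)) eq)

  length-concatMap≤ : ∀ {B : Set} (f : A → List B) c {xs} →
                      (∀ {x} → x ∈ˡ xs → length (f x) ≤ c) → length (concatMap f xs) ≤ c * length xs
  length-concatMap≤ f c {[]}     _     = z≤n
  length-concatMap≤ f c {x ∷ xs} bound = begin
    length (f x ++ concatMap f xs)         ≡⟨ length-++ (f x) ⟩
    length (f x) + length (concatMap f xs) ≤⟨ +-mono-≤ (bound (here refl))
                                                        (length-concatMap≤ f c (bound ∘ there)) ⟩
    c + c * length xs                      ≡⟨ sym (*-suc c (length xs)) ⟩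
    c * suc (length xs)                    ∎
    where open ≤-Reasoning

∣p∪q∣≤∣p∣+∣q∣ : ∀ {n} (p q : Subset n) → ∣ p ∪ q ∣ ≤ ∣ p ∣ + ∣ q ∣
∣p∪q∣≤∣p∣+∣q∣ []            []            = z≤n
∣p∪q∣≤∣p∣+∣q∣ (outside ∷ p) (outside ∷ q) = ∣p∪q∣≤∣p∣+∣q∣ p q
∣p∪q∣≤∣p∣+∣q∣ (outside ∷ p) (inside  ∷ q) =
  ≤-trans (s≤s (∣p∪q∣≤∣p∣+∣q∣ p q)) (≤-reflexive (sym (+-suc ∣ p ∣ ∣ q ∣)))
∣p∪q∣≤∣p∣+∣q∣ (inside  ∷ p) (outside ∷ q) = s≤s (∣p∪q∣≤∣p∣+∣q∣ p q)
∣p∪q∣≤∣p∣+∣q∣ (inside  ∷ p) (inside  ∷ q) =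
  s≤s (≤-trans (∣p∪q∣≤∣p∣+∣q∣ p q) (+-monoʳ-≤ ∣ p ∣ (n≤1+n ∣ q ∣)))

fromList : ∀ {n} → List (Fin n) → Subset n
fromList xs = ⋃ (map ⁅_⁆ xs)

∣fromList∣≤length : ∀ {n} (xs : List (Fin n)) → ∣ fromList xs ∣ ≤ length xs
∣fromList∣≤length {n} []       = ≤-reflexive (∣⊥∣≡0 n)
∣fromList∣≤length     (x ∷ xs) = begin
  ∣ ⁅ x ⁆ ∪ fromList xs ∣     ≤⟨ ∣p∪q∣≤∣p∣+∣q∣ ⁅ x ⁆ (fromList xs) ⟩
  ∣ ⁅ x ⁆ ∣ + ∣ fromList xs ∣ ≤⟨ +-mono-≤ (≤-reflexive (∣⁅x⁆∣≡1 x)) (∣fromList∣≤length xs) ⟩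
  suc (length xs)             ∎
  where open ≤-Reasoning

∈ˡ⇒∈fromList : ∀ {n} {x : Fin n} {xs} → x ∈ˡ xs → x ∈ fromList xs
∈ˡ⇒∈fromList (here refl)  = x∈p∪q⁺ (inj₁ (x∈⁅x⁆ _))
∈ˡ⇒∈fromList (there x∈xs) = x∈p∪q⁺ (inj₂ (∈ˡ⇒∈fromList x∈xs))

∣p∣≤length : ∀ {n} {p : Subset n} {xs} → (∀ {x} → x ∈ p → x ∈ˡ xs) → ∣ p ∣ ≤ length xs
∣p∣≤length {xs = xs} p⊆xs = ≤-trans (p⊆q⇒∣p∣≤∣q∣ (∈ˡ⇒∈fromList ∘ p⊆xs)) (∣fromList∣≤length xs)

∃≢ : ∀ {n} → 2 ≤ n → (v : Fin n) → ∃ λ u → u ≢ v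
∃≢ (s≤s (s≤s _)) v = punchIn v zero , punchInᵢ≢i v zero

module Triangulation {n D : ℕ} (G : PlanarTriangulation n D) where
  open PlanarTriangulation G

  head : Fin D → Fin n
  head d = tail (α d)

  -- The face through d is the triangle tail d, head d, apex d.
  apex : Fin D → Fin n
  apex d = head (φ d)

  head-α : ∀ d → head (α d) ≡ tail d
  head-α d = cong tail (α-invol d)

  tail-φ : ∀ d → tail (φ d) ≡ head d
  tail-φ d = σ-tail (α d)

  head-φ² : ∀ d → head (φ (φ d)) ≡ tail d
  head-φ² d = trans (sym (tail-φ (φ (φ d)))) (cong tail (face-tri d))

  Adj-sym : ∀ {u v} → Adj u v → Adj v u
  Adj-sym (d , refl , refl) = α d , refl , head-α d

  Adj⇒≢ : ∀ {u v} → Adj u v → u ≢ v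
  Adj⇒≢ (d , refl , refl) eq = no-loop d (sym eq)

  head-adj-apex : ∀ d → Adj (head d) (apex d)
  head-adj-apex d = φ d , tail-φ d , refl

  apex-adj-tail : ∀ d → Adj (apex d) (tail d)
  apex-adj-tail d = φ (φ d) , tail-φ (φ d) , head-φ² d

  neighbours : Fin n → List (Fin n)
  neighbours w = filter (adj? G w) (allFin n)

  ∈neighbours⁺ : ∀ {w u} → Adj w u → u ∈ˡ neighbours w
  ∈neighbours⁺ {w} {u} = ∈-filter⁺ (adj? G w) (∈-allFin u)

  ∈neighbours⁻ : ∀ {w u} → u ∈ˡ neighbours w → Adj w u
  ∈neighbours⁻ {w} = proj₂ ∘ ∈-filter⁻ (adj? G w) {xs = allFin n}

  neighbours-unique : ∀ w → Unique (neighbours w)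
  neighbours-unique w = Unique.filter⁺ (adj? G w) (Unique.allFin⁺ n)

  Unique-Adj⇒length≤deg : ∀ {w xs} → Unique xs → (∀ {u} → u ∈ˡ xs → Adj w u) → length xs ≤ deg G w
  Unique-Adj⇒length≤deg u adj = Unique⇒length≤ u (∈neighbours⁺ ∘ adj)

  σ²≡id⇒Adj : ∀ {d u} → σ (σ d) ≡ d → Adj (tail d) u → u ≡ head d ⊎ u ≡ head (σ d)
  σ²≡id⇒Adj {d} σ²d≡d (d′ , d′-at-d , refl) =
    let i , σⁱd≡d′ = σ-trans d d′ (sym d′-at-d)
    in  Sum.map (cong head ∘ trans (sym σⁱd≡d′)) (cong head ∘ trans (sym σⁱd≡d′)) (orbit i)
    where
      orbit : ∀ i → iterate σ i d ≡ d ⊎ iterate σ i d ≡ σ d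
      orbit zero    = inj₁ refl
      orbit (suc i) with orbit i
      ... | inj₁ eq = inj₂ (cong σ eq)
      ... | inj₂ eq = inj₁ (trans (cong σ eq) σ²d≡d)

  -- Around head e the rotation σ visits α (φ² (α e)), α e, φ e, whose heads are
  -- apex (α e), tail e, apex e; a simple graph cannot have two darts to one apex.
  apex-collision⇒σ²≡id : ∀ e → apex e ≡ apex (α e) → σ (σ (α e)) ≡ α e
  apex-collision⇒σ²≡id e collision = begin
    σ (σ (α e)) ≡⟨ cong σ (no-multi (φ e) d′ same-tail same-head) ⟩
    σ d′        ≡⟨ face-tri (α e) ⟩
    α e         ∎
    where
      open ≡-Reasoning
      d′ = α (φ (φ (α e)))
      same-tail : tail (φ e) ≡ tail d′
      same-tail = trans (tail-φ e) (sym (head-φ² (α e)))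
      same-head : head (φ e) ≡ head d′
      same-head = trans collision (sym (trans (head-α (φ (φ (α e)))) (tail-φ (φ (α e)))))

  Far : Fin n → Fin n → Set
  Far p u = u ≢ p × ¬ Adj p u

  far? : ∀ p u → Dec (Far p u)
  far? p u = ¬? (u ≟ᶠ p) ×-dec ¬? (adj? G p u)

  beyond : Fin n → Fin n → List (Fin n)
  beyond p w = filter (far? p) (neighbours w)

  ∈beyond⁺ : ∀ {p w u} → Adj w u → Far p u → u ∈ˡ beyond p w
  ∈beyond⁺ {p} w-u = ∈-filter⁺ (far? p) (∈neighbours⁺ w-u)

  ∈beyond⁻ : ∀ {p w u} → u ∈ˡ beyond p w → Adj w u × Far p u
  ∈beyond⁻ {p} {w} h = let u∈N , far = ∈-filter⁻ (far? p) {xs = neighbours w} h in ∈neighbours⁻ u∈N , far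

  beyond-unique : ∀ p w → Unique (beyond p w)
  beyond-unique p w = Unique.filter⁺ (far? p) (neighbours-unique w)

  module _ (e : Fin D) where
    private
      p = tail e
      w = head e
      x = apex e
      y = apex (α e)

      p-x : Adj p x
      p-x = Adj-sym (apex-adj-tail e)

      p-y : Adj p y
      p-y = subst (λ v → Adj v y) (head-α e) (head-adj-apex (α e))

      p∉beyond : All (p ≢_) (beyond p w)
      p∉beyond = All.tabulate (λ h → proj₁ (proj₂ (∈beyond⁻ h)) ∘ sym)

      Adj-p⇒∉beyond : ∀ {v} → Adj p v → All (v ≢_) (beyond p w)
      Adj-p⇒∉beyond p-v = All.tabulate (λ h v≡u → proj₂ (proj₂ (∈beyond⁻ h)) (subst (Adj p) v≡u p-v))

    apex-collision⇒length-beyond≤0 : apex e ≡ apex (α e) → length (beyond p w) ≤ 0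
    apex-collision⇒length-beyond≤0 x≡y = Unique⇒length≤ (beyond-unique p w) beyond⊆[]
      where
        beyond⊆[] : beyond p w ⊆ˡ []
        beyond⊆[] h with w-u , u≢p , ¬p-u ← ∈beyond⁻ h
                    with σ²≡id⇒Adj (apex-collision⇒σ²≡id e x≡y) w-u
        ... | inj₁ u≡p = contradiction (trans u≡p (head-α e)) u≢p
        ... | inj₂ u≡x = contradiction (subst (Adj p) (sym u≡x) p-x) ¬p-u

    apex-distinct⇒3+length-beyond≤deg : apex e ≢ apex (α e) → 3 + length (beyond p w) ≤ deg G w
    apex-distinct⇒3+length-beyond≤deg x≢y = Unique-Adj⇒length≤deg distinct adjacent
      where
        distinct : Unique (p ∷ x ∷ y ∷ beyond p w)
        distinct = (Adj⇒≢ p-x ∷ Adj⇒≢ p-y ∷ p∉beyond)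
                 ∷ (x≢y ∷ Adj-p⇒∉beyond p-x)
                 ∷ Adj-p⇒∉beyond p-y
                 ∷ beyond-unique p w

        adjacent : ∀ {u} → u ∈ˡ (p ∷ x ∷ y ∷ beyond p w) → Adj w u
        adjacent (here refl)                 = Adj-sym (e , refl , refl)
        adjacent (there (here refl))         = head-adj-apex e
        adjacent (there (there (here refl))) = Adj-sym (apex-adj-tail (α e))
        adjacent (there (there (there h)))   = proj₁ (∈beyond⁻ h)

    length-beyond≤deg∸3 : length (beyond p w) ≤ deg G w ∸ 3
    length-beyond≤deg∸3 with apex e ≟ᶠ apex (α e)
    ... | yes x≡y = ≤-trans (apex-collision⇒length-beyond≤0 x≡y) z≤n
    ... | no  x≢y = m+n≤o⇒m≤o∸n (length (beyond p w))
                      (subst (_≤ deg G w) (+-comm 3 (length (beyond p w)))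
                             (apex-distinct⇒3+length-beyond≤deg x≢y))

  length-beyond≤5 : ∀ {p w} → Adj p w → deg G w ≤ 8 → length (beyond p w) ≤ 5
  length-beyond≤5 (e , refl , refl) w≤8 = ≤-trans (length-beyond≤deg∸3 e) (∸-monoˡ-≤ 3 w≤8)

  deg-tail≥2 : ∀ d → 2 ≤ deg G (tail d)
  deg-tail≥2 d = Unique-Adj⇒length≤deg ((Adj⇒≢ (head-adj-apex d) ∷ []) ∷ [] ∷ []) adjacent
    where
      adjacent : ∀ {u} → u ∈ˡ (head d ∷ apex d ∷ []) → Adj (tail d) u
      adjacent (here refl)         = d , refl , refl
      adjacent (there (here refl)) = Adj-sym (apex-adj-tail d)

  -- Euler's formula 6n = D + 12 forces n ≥ 2.
  has-neighbour : ∀ v → ∃ (Adj v)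
  has-neighbour v with u , u≢v ← ∃≢ (*-cancelˡ-≤ 6 (subst (12 ≤_) (sym euler) (m≤n+m 12 D))) v
                  with connected v u
  ... | ε       = contradiction refl u≢v
  ... | v-c ◅ _ = _ , v-c

  deg≥2 : ∀ v → 2 ≤ deg G v
  deg≥2 v with _ , d , refl , _ ← has-neighbour v = deg-tail≥2 d

module Exploration {n D : ℕ} (G : PlanarTriangulation n D) (v₀ : Fin n) where
  open PlanarTriangulation G
  open Triangulation G
  open Path using (vtx; start; end)

  Transit : Fin n → Set
  Transit w = w ≡ v₀ ⊎ deg G w ≤ 8

  expand : Fin n × Fin n → List (Fin n × Fin n)
  expand (p , w) = map (w ,_) (beyond p w)

  low-degree? : (e : Fin n × Fin n) → Dec (deg G (proj₂ e) ≤ 8)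
  low-degree? (_ , w) = deg G w ≤? 8

  frontier : ℕ → List (Fin n × Fin n)
  frontier zero    = map (v₀ ,_) (neighbours v₀)
  frontier (suc i) = concatMap expand (filter low-degree? (frontier i))

  ball : ℕ → List (Fin n)
  ball zero    = v₀ ∷ []
  ball (suc i) = ball i ++ map proj₂ (frontier i)

  ball-mono : ∀ {i j} → i ≤ j → ball i ⊆ˡ ball j
  ball-mono = mono ∘ ≤⇒≤′
    where
      mono : ∀ {i j} → i ≤′ j → ball i ⊆ˡ ball j
      mono ≤′-refl       = id
      mono (≤′-step le) = ∈-++⁺ˡ ∘ mono le

  v₀∈ball : ∀ i → v₀ ∈ˡ ball i
  v₀∈ball i = ball-mono {0} {i} z≤n (here refl)

  frontier⊆ball : ∀ i {p w} → (p , w) ∈ˡ frontier i → w ∈ˡ ball (suc i)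
  frontier⊆ball i h = ∈-++⁺ʳ (ball i) (∈-map⁺ proj₂ h)

  frontier-edge : ∀ i {p w} → (p , w) ∈ˡ frontier i → Adj p w × Transit p × p ∈ˡ ball i
  frontier-edge zero h with _ , w∈N , refl ← ∈-map⁻ (v₀ ,_) h = ∈neighbours⁻ w∈N , inj₁ refl , here refl
  frontier-edge (suc i) h
    with (p′ , w′) , pw∈ , wu∈ ← find (∈-concatMap⁻ expand {xs = filter low-degree? (frontier i)} h)
    with pw∈F , w′≤8 ← ∈-filter⁻ low-degree? {xs = frontier i} pw∈
    with _ , u∈ , refl ← ∈-map⁻ (w′ ,_) wu∈
    = proj₁ (∈beyond⁻ u∈) , inj₂ w′≤8 , frontier⊆ball i pw∈F

  frontier-step : ∀ i {p w v} → (p , w) ∈ˡ frontier i → deg G w ≤ 8 → v ∈ˡ beyond p w →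
                  (w , v) ∈ˡ frontier (suc i)
  frontier-step i pw∈ w≤8 v∈ = ∈-concatMap⁺ expand (lose (∈-filter⁺ low-degree? pw∈ w≤8) (∈-map⁺ (_ ,_) v∈))

  ball-closed : ∀ i {w v} → w ∈ˡ ball i → Transit w → Adj w v → v ∈ˡ ball (suc i)
  ball-closed zero    (here refl) _ w-v = frontier⊆ball 0 (∈-map⁺ (v₀ ,_) (∈neighbours⁺ w-v))
  ball-closed (suc i) _ (inj₁ refl) w-v = ∈-++⁺ˡ (ball-closed i (v₀∈ball i) (inj₁ refl) w-v)
  ball-closed (suc i) {v = v} w∈ (inj₂ w≤8) w-v with ∈-++⁻ (ball i) w∈
  ... | inj₁ w∈ball = ∈-++⁺ˡ (ball-closed i w∈ball (inj₂ w≤8) w-v)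
  ... | inj₂ w∈heads with (p , _) , pw∈ , refl ← ∈-map⁻ proj₂ w∈heads
                     with p-w , p-transit , p∈ball ← frontier-edge i pw∈
                     with v ≟ᶠ p | adj? G p v
  ...   | yes refl | _       = ball-mono (n≤1+n (suc i)) (∈-++⁺ˡ p∈ball)
  ...   | no _     | yes p-v = ∈-++⁺ˡ (ball-closed i p∈ball p-transit p-v)
  ...   | no v≢p   | no ¬p-v = frontier⊆ball (suc i) (frontier-step i pw∈ w≤8 (∈beyond⁺ w-v (v≢p , ¬p-v)))

  path-end∈ball : ∀ {ℓ k v} (P : Path G ℓ v₀ v) → (∀ i → Transit (vtx P (inject₁ i))) → ℓ ≤ k → v ∈ˡ ball k
  path-end∈ball {ℓ} P transit ℓ≤k =
    ball-mono ℓ≤k (subst₂ (λ u m → u ∈ˡ ball m) (end P) (toℕ-fromℕ ℓ) (vtx∈ball (fromℕ ℓ)))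
    where
      vtx∈ball : ∀ j → vtx P j ∈ˡ ball (toℕ j)
      vtx∈ball = <-weakInduction (λ j → vtx P j ∈ˡ ball (toℕ j)) (here (start P)) λ i h →
        ball-closed (toℕ i) (subst (λ m → vtx P (inject₁ i) ∈ˡ ball m) (toℕ-inject₁ i) h)
                    (transit i) (Path.step P i)

  InExtBall⇒∈ball : ∀ {k v} → InExtBall G k v₀ v → v ∈ˡ ball k
  InExtBall⇒∈ball (inj₁ (ℓ , ℓ≤k , P , low)) = path-end∈ball P transit ℓ≤k
    where
      transit : ∀ i → Transit (vtx P (inject₁ i))
      transit zero    = inj₁ (start P)
      transit (suc i) = inj₂ (low (suc (inject₁ i)) λ ())
  InExtBall⇒∈ball (inj₂ (_ , _ , ℓ , ℓ≤k , P , low)) = path-end∈ball P transit ℓ≤k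
    where
      transit : ∀ i → Transit (vtx P (inject₁ i))
      transit zero    = inj₁ (start P)
      transit (suc i) = inj₂ (low (suc (inject₁ i)) (λ ()) (fromℕ≢inject₁ ∘ sym))

  length-frontier : ∀ i → length (frontier i) ≤ 5 ^ i * deg G v₀
  length-frontier zero    = ≤-reflexive (trans (length-map (v₀ ,_) (neighbours v₀)) (sym (*-identityˡ _)))
  length-frontier (suc i) = begin
    length (concatMap expand (filter low-degree? (frontier i))) ≤⟨ length-concatMap≤ expand 5 expand≤5 ⟩
    5 * length (filter low-degree? (frontier i))                ≤⟨ *-monoʳ-≤ 5 (length-filter low-degree? (frontier i)) ⟩
    5 * length (frontier i)                                     ≤⟨ *-monoʳ-≤ 5 (length-frontier i) ⟩
    5 * (5 ^ i * deg G v₀)                                      ≡⟨ sym (*-assoc 5 (5 ^ i) _) ⟩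
    5 ^ suc i * deg G v₀                                        ∎
    where
      open ≤-Reasoning
      expand≤5 : ∀ {e} → e ∈ˡ filter low-degree? (frontier i) → length (expand e) ≤ 5
      expand≤5 {p , w} h with pw∈ , w≤8 ← ∈-filter⁻ low-degree? {xs = frontier i} h =
        subst (_≤ 5) (sym (length-map (w ,_) (beyond p w)))
              (length-beyond≤5 (proj₁ (frontier-edge i pw∈)) w≤8)

  length-ball : ∀ k → length (ball k) < 5 ^ k * deg G v₀
  length-ball zero    = ≤-trans (deg≥2 v₀) (≤-reflexive (sym (*-identityˡ _)))
  length-ball (suc k) = begin-strict
    length (ball k ++ map proj₂ (frontier k))         ≡⟨ length-++ (ball k) ⟩
    length (ball k) + length (map proj₂ (frontier k)) ≡⟨ cong (length (ball k) +_) (length-map proj₂ (frontier k)) ⟩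
    length (ball k) + length (frontier k)             <⟨ +-mono-<-≤ (length-ball k) (length-frontier k) ⟩
    M + M                                             ≤⟨ +-monoʳ-≤ M (m≤n*m M 4) ⟩
    5 * M                                             ≡⟨ sym (*-assoc 5 (5 ^ k) _) ⟩
    5 ^ suc k * deg G v₀                              ∎
    where
      open ≤-Reasoning
      M = 5 ^ k * deg G v₀

lemma6p3 : ∀ {n D : ℕ} (G : PlanarTriangulation n D) (v₀ : Fin n) (k : ℕ)
    → (S : Subset n) → (∀ v → v ∈ S → InExtBall G k v₀ v)
    → ∣ S ∣ < 5 ^ k * deg G v₀
lemma6p3 G v₀ k S S⊆B̄ = begin-strict
  ∣ S ∣            ≤⟨ ∣p∣≤length (λ {v} v∈S → InExtBall⇒∈ball (S⊆B̄ v v∈S)) ⟩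
  length (ball k)  <⟨ length-ball k ⟩
  5 ^ k * deg G v₀ ∎
  where
    open Exploration G v₀
    open ≤-Reasoning
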